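{- Let $n = 3p+r \geq 9$ where $p$ is a positive integer and $r \in \{0,1,2\}$. Then $\mathrm{MOF}(K_n) \geq p + 2\,\mathrm{MOF}(K_p) - 3$.
   Context: An orientation of a simple graph $G$ assigns to each edge $\{u,v\}$ exactly one of the arcs $(u,v)$ or $(v,u)$; if $(u,v)$ is an arc, $v$ is an out-neighbor of $u$. Oriented forcing: given an orientation $D$ and a set $S$ of initially colored vertices, any colored vertex having at most $1$ non-colored out-neighbor forces that out-neighbor to become colored; this rule is applied iteratively as long as possible. $S$ is a forcing set of $D$ if at the end every vertex is colored. $F(D)$ is the minimum size of a forcing set of $D$, and $\mathrm{MOF}(G)$ is the maximum of $F(D)$ over all orientations $D$ of $G$. $K_n$ is the complete graph on $n$ vertices. -}

module Defs where

open import Data.Nat using (ℕ; _≤_)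
open import Data.Bool using (Bool; true; false; not)
open import Data.Fin using (Fin)
open import Data.Fin.Subset using (Subset; _∈_; ∣_∣)
open import Data.Product using (Σ; ∃; _×_)
open import Relation.Binary.PropositionalEquality using (_≡_; _≢_)

Digraph : ℕ → Set
Digraph n = Fin n → Fin n → Bool

IsOrientationK : (n : ℕ) → Digraph n → Set
IsOrientationK n A =
  (∀ (i : Fin n) → A i i ≡ false) ×
  (∀ (i j : Fin n) → i ≢ j → A j i ≡ not (A i j))

-- Vertices colored at the end of the oriented forcing process started from S
-- (least set containing S closed under the forcing rule: a colored u with
-- out-neighbour v, all of whose other out-neighbours are colored, forces v).
data Colored {n : ℕ} (A : Digraph n) (S : Subset n) : Fin n → Set where
  initial : ∀ {v} → v ∈ S → Colored A S v
  force   : ∀ {u v} → Colored A S u → A u v ≡ true →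
            (∀ w → A u w ≡ true → w ≢ v → Colored A S w) →
            Colored A S v

IsForcingSet : {n : ℕ} → Digraph n → Subset n → Set
IsForcingSet {n} A S = ∀ (v : Fin n) → Colored A S v

IsF : {n : ℕ} → Digraph n → ℕ → Set
IsF {n} A k =
  (Σ (Subset n) λ S → IsForcingSet A S × ∣ S ∣ ≡ k) ×
  (∀ (S : Subset n) → IsForcingSet A S → k ≤ ∣ S ∣)

IsMOFK : ℕ → ℕ → Set
IsMOFK n m =
  (Σ (Digraph n) λ A → IsOrientationK n A × IsF A m) ×
  (∀ (A : Digraph n) → IsOrientationK n A → ∀ k → IsF A k → k ≤ m)

module Submission where

-- Let A be an orientation of K_p with F(A) = MOF(K_p) = a.  The
-- orientation D of K_n consists of three copies of A, arranged in a directed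
-- triangle (every vertex of copy b points to every vertex of copy b+1 mod 3),
-- together with r extra vertices that receive arcs from all copies and are
-- ordered transitively among themselves.
--
-- Let S be a forcing set of D and S_b its trace on copy b.  The argument
-- uses forts: a set U of uncolored vertices such that any vertex outside U with
-- an out-neighbour in U has a second one in U; such a set never gets colored.
--   (1) Each S_b colors all but at most one vertex of A (otherwise those vertices
--       form a fort of D), hence a ≤ |S_b| + 1.
--   (2) Some S_b misses at most one vertex of its copy (otherwise the
--       complements of the S_b form a fort of D), hence p ≤ |S_b| + 1.
-- Adding up, p + 2a ≤ |S| + 3, so F(D) ≥ p + 2a − 3 and MOF(K_n) ≥ F(D).

open import Defs
open import Data.Nat using (ℕ; zero; suc; _+_; _*_; _≤_; _<_; _<ᵇ_; _≤?_; z≤n; s≤s)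
open import Data.Nat.Properties
  using (≤-trans; ≤-reflexive; n≤1+n; m≤m+n; +-suc; +-monoʳ-≤; +-monoˡ-≤; +-mono-≤;
         +-comm; +-assoc; ≤-<-trans; <⇒≱; ≰⇒>; module ≤-Reasoning)
  renaming (_≟_ to _≟ℕ_)
open import Data.Nat.Solver using (module +-*-Solver)
open import Data.Bool using (Bool; true; false; not)
open import Data.Bool.Properties using () renaming (_≟_ to _≟𝔹_)
open import Data.Fin using (Fin; zero; suc; toℕ; fromℕ; fromℕ<; inject; _↑ˡ_; _↑ʳ_)
open import Data.Fin.Properties
  using (any?; all?; ¬∀⟶∃¬; ¬∀⟶∃¬-smallest; toℕ-fromℕ; toℕ-fromℕ<; toℕ-inject;
         toℕ-injective; +↔⊎)
  renaming (_≟_ to _≟F_)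
open import Data.Fin.Subset using (Subset; _∈_; _∉_; _⊆_; ∣_∣; ⊤; ⁅_⁆; _∪_; inside; outside)
open import Data.Fin.Subset.Properties
  using (_∈?_; anySubset?; ∈⊤; x∈⁅x⁆; x∈⁅y⁆⇒x≡y; p⊆p∪q; q⊆p∪q; x∈p∪q⁻;
         p⊆q⇒∣p∣≤∣q∣; p⊂q⇒∣p∣<∣q∣; ∣p∣≤n; ∣⊤∣≡n; ∪-identityʳ)
open import Data.Vec using (Vec; _∷_; take; drop; here; there; _[_]=_)
open import Data.Product using (∃; ∃₂; _×_; _,_; proj₁; proj₂)
open import Data.Sum using (_⊎_; inj₁; inj₂; [_,_]′)
open import Data.Empty using (⊥; ⊥-elim)
open import Function using (_∘_; id)
open import Function.Bundles using (_↔_; Inverse; mk↔ₛ′)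
open import Function.Properties.Inverse using (↔-trans; ↔-refl)
open import Data.Sum.Function.Propositional using (_⊎-↔_)
open import Relation.Nullary using (¬_; Dec; yes; no; contradiction)
open import Relation.Nullary.Decidable using (decidable-stable; ¬?; _×-dec_; _→-dec_)
open import Relation.Unary using (Decidable)
open import Relation.Binary.PropositionalEquality
  using (_≡_; _≢_; refl; sym; trans; cong; subst)

IsFort : {V : Set} → (V → V → Bool) → (V → Set) → Set
IsFort {V} arc U = ∀ (c v : V) → ¬ U c → U v → arc c v ≡ true →
                   ∃ λ w → U w × w ≢ v × arc c w ≡ true

TwoOf : ∀ {m} → (Fin m → Set) → Set
TwoOf P = ∃₂ λ u v → u ≢ v × P u × P v

avoid : ∀ {m} {P : Fin m → Set} → TwoOf P → ∀ y → ∃ λ u → P u × u ≢ y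
avoid (u , v , u≢v , Pu , Pv) y with u ≟F y
... | yes refl = v , Pv , λ v≡u → u≢v (sym v≡u)
... | no  u≢y  = u , Pu , u≢y

AllButOne : ∀ {m} → (Fin m → Set) → Set
AllButOne P = ∀ u v → ¬ P u → ¬ P v → u ≡ v

two-or-allButOne : ∀ {m} {P : Fin m → Set} → Decidable P → TwoOf (¬_ ∘ P) ⊎ AllButOne P
two-or-allButOne P? with any? (λ u → any? λ v → ¬? (u ≟F v) ×-dec ¬? (P? u) ×-dec ¬? (P? v))
... | yes (u , v , two) = inj₁ (u , v , two)
... | no  none          = inj₂ λ u v ¬Pu ¬Pv →
  decidable-stable (u ≟F v) (λ u≢v → none (u , v , u≢v , ¬Pu , ¬Pv))

allButOne-cover : ∀ {m} {P : Fin m → Set} → Decidable P → AllButOne P →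
                  (∀ x → P x) ⊎ ∃ λ v → ∀ x → P x ⊎ x ≡ v
allButOne-cover {P = P} P? one with any? (¬? ∘ P?)
... | no  none       = inj₁ λ x → decidable-stable (P? x) (λ ¬Px → none (x , ¬Px))
... | yes (v , ¬Pv)  = inj₂ (v , cover)
  where
  cover : ∀ x → P x ⊎ x ≡ v
  cover x with P? x
  ... | yes Px  = inj₁ Px
  ... | no  ¬Px = inj₂ (one x v ¬Px ¬Pv)

∣p∪⁅x⁆∣≤1+∣p∣ : ∀ {m} (p : Subset m) x → ∣ p ∪ ⁅ x ⁆ ∣ ≤ suc ∣ p ∣
∣p∪⁅x⁆∣≤1+∣p∣ (inside  ∷ p) zero    = s≤s (≤-trans (≤-reflexive (cong ∣_∣ (∪-identityʳ p))) (n≤1+n ∣ p ∣))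
∣p∪⁅x⁆∣≤1+∣p∣ (outside ∷ p) zero    = s≤s (≤-reflexive (cong ∣_∣ (∪-identityʳ p)))
∣p∪⁅x⁆∣≤1+∣p∣ (inside  ∷ p) (suc x) = s≤s (∣p∪⁅x⁆∣≤1+∣p∣ p x)
∣p∪⁅x⁆∣≤1+∣p∣ (outside ∷ p) (suc x) = ∣p∪⁅x⁆∣≤1+∣p∣ p x

full-size : ∀ {m} (T : Subset m) → (∀ x → x ∈ T) → m ≤ ∣ T ∣
full-size {m} T all = ≤-trans (≤-reflexive (sym (∣⊤∣≡n m))) (p⊆q⇒∣p∣≤∣q∣ {p = ⊤} (λ {x} _ → all x))

allButOne-size : ∀ {m} (T : Subset m) → AllButOne (_∈ T) → m ≤ suc ∣ T ∣
allButOne-size T one with allButOne-cover (_∈? T) one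
... | inj₁ all         = ≤-trans (full-size T all) (n≤1+n ∣ T ∣)
... | inj₂ (v , cover) =
  ≤-trans (full-size (T ∪ ⁅ v ⁆) (λ x → [ p⊆p∪q ⁅ v ⁆ , into⁅v⁆ ]′ (cover x)))
          (∣p∪⁅x⁆∣≤1+∣p∣ T v)
  where
  into⁅v⁆ : ∀ {x} → x ≡ v → x ∈ T ∪ ⁅ v ⁆
  into⁅v⁆ refl = q⊆p∪q T ⁅ v ⁆ (x∈⁅x⁆ v)

least : ∀ {Q : ℕ → Set} → (∀ j → Dec (Q j)) → ∀ m → Q m →
        ∃ λ k → Q k × (∀ j → Q j → k ≤ j)
least {Q} Q? m Qm
  with ¬∀⟶∃¬-smallest (suc m) (λ i → ¬ Q (toℕ i)) (λ i → ¬? (Q? (toℕ i)))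
                       (λ none → none (fromℕ m) (subst Q (sym (toℕ-fromℕ m)) Qm))
... | i , ¬¬Qi , below = toℕ i , decidable-stable (Q? (toℕ i)) ¬¬Qi , minimal
  where
  minimal : ∀ j → Q j → toℕ i ≤ j
  minimal j Qj with toℕ i ≤? j
  ... | yes i≤j = i≤j
  ... | no  i≰j = contradiction (subst Q (sym (trans (toℕ-inject k) (toℕ-fromℕ< j<i))) Qj)
                                (below k)
    where
    j<i : j < toℕ i
    j<i = ≰⇒> i≰j
    k : Fin (toℕ i)
    k = fromℕ< j<i

module Forcing {m : ℕ} (A : Digraph m) where

  colored-mono : ∀ {S S′} → S ⊆ S′ → ∀ {v} → Colored A S v → Colored A S′ v
  colored-mono S⊆S′ (initial v∈S)      = initial (S⊆S′ v∈S)
  colored-mono S⊆S′ (force cu e others) =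
    force (colored-mono S⊆S′ cu) e (λ w e′ w≢v → colored-mono S⊆S′ (others w e′ w≢v))

  -- A fort disjoint from the initial set is never colored: no vertex outside
  -- the fort can ever force into it.
  fort-uncolored : ∀ {S} (U : Fin m → Set) → IsFort A U → (∀ v → v ∈ S → ¬ U v) →
                   ∀ {v} → Colored A S v → ¬ U v
  fort-uncolored U fort disjoint (initial v∈S) = disjoint _ v∈S
  fort-uncolored U fort disjoint (force {u} {v} cu e others) Uv
    with fort u v (fort-uncolored U fort disjoint cu) Uv e
  ... | w , Uw , w≢v , e′ = fort-uncolored U fort disjoint (others w e′ w≢v) Uw

  Closed : Subset m → Set
  Closed C = ∀ {c v} → c ∈ C → A c v ≡ true →
             (∀ w → A c w ≡ true → w ≢ v → w ∈ C) → v ∈ C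

  colored-in-closed : ∀ {S C} → S ⊆ C → Closed C → ∀ {v} → Colored A S v → v ∈ C
  colored-in-closed S⊆C closed (initial v∈S)      = S⊆C v∈S
  colored-in-closed S⊆C closed (force cu e others) =
    closed (colored-in-closed S⊆C closed cu) e
           (λ w e′ w≢v → colored-in-closed S⊆C closed (others w e′ w≢v))

  Step : Subset m → Fin m → Fin m → Set
  Step C c v = c ∈ C × v ∉ C × A c v ≡ true × (∀ w → A c w ≡ true → w ≢ v → w ∈ C)

  step? : ∀ C → Dec (∃₂ (Step C))
  step? C = any? λ c → any? λ v →
    (c ∈? C) ×-dec ¬? (v ∈? C) ×-dec (A c v ≟𝔹 true) ×-dec
    all? (λ w → (A c w ≟𝔹 true) →-dec (¬? (w ≟F v) →-dec (w ∈? C)))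

  no-step⇒closed : ∀ {C} → ¬ ∃₂ (Step C) → Closed C
  no-step⇒closed {C} none {c} {v} c∈C e others =
    decidable-stable (v ∈? C) (λ v∉C → none (c , v , c∈C , v∉C , e , others))

  record Saturation (S : Subset m) : Set where
    field
      C         : Subset m
      S⊆C       : S ⊆ C
      C⊆colored : ∀ {v} → v ∈ C → Colored A S v
      closed    : Closed C

  -- Apply forcing steps until none is available; each step enlarges C, so the
  -- fuel k with m ≤ k + ∣ C ∣ suffices.
  saturate : ∀ {S} k C → m ≤ k + ∣ C ∣ → S ⊆ C →
             (∀ {v} → v ∈ C → Colored A S v) → Saturation S
  saturate {S} k C fuel S⊆C C⊆colored with step? C
  ... | no none = record { C = C ; S⊆C = S⊆C ; C⊆colored = C⊆colored
                         ; closed = no-step⇒closed none }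
  ... | yes (c , v , c∈C , v∉C , e , others) = continue k fuel
    where
    C′ : Subset m
    C′ = C ∪ ⁅ v ⁆

    grows : ∣ C ∣ < ∣ C′ ∣
    grows = p⊂q⇒∣p∣<∣q∣ (p⊆p∪q ⁅ v ⁆ , v , q⊆p∪q C ⁅ v ⁆ (x∈⁅x⁆ v) , v∉C)

    C′⊆colored : ∀ {x} → x ∈ C′ → Colored A S x
    C′⊆colored x∈C′ with x∈p∪q⁻ C ⁅ v ⁆ x∈C′
    ... | inj₁ x∈C = C⊆colored x∈C
    ... | inj₂ x∈⁅v⁆ with x∈⁅y⁆⇒x≡y v x∈⁅v⁆
    ... | refl = force (C⊆colored c∈C) e (λ w e′ w≢v → C⊆colored (others w e′ w≢v))

    continue : ∀ k → m ≤ k + ∣ C ∣ → Saturation S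
    continue zero    fuel′ = contradiction (∣p∣≤n C′) (<⇒≱ (≤-<-trans fuel′ grows))
    continue (suc k) fuel′ =
      saturate k C′ (≤-trans fuel′ (≤-trans (≤-reflexive (sym (+-suc k ∣ C ∣))) (+-monoʳ-≤ k grows)))
               (p⊆p∪q ⁅ v ⁆ ∘ S⊆C) C′⊆colored

  saturation : ∀ S → Saturation S
  saturation S = saturate m S (m≤m+n m ∣ S ∣) id initial

  colored? : ∀ S v → Dec (Colored A S v)
  colored? S v with v ∈? Saturation.C (saturation S)
  ... | yes v∈C = yes (Saturation.C⊆colored (saturation S) v∈C)
  ... | no  v∉C = no λ cv → v∉C (colored-in-closed S⊆C closed cv)
    where open Saturation (saturation S)

  forcing? : ∀ S → Dec (IsForcingSet A S)
  forcing? S = all? (colored? S)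

  -- The uncolored vertices form a fort: were all other out-neighbours of a
  -- colored vertex colored, it would force the remaining one.
  uncolored-fort : ∀ S → IsFort A (λ v → ¬ Colored A S v)
  uncolored-fort S c v ¬¬cc ¬cv e
    with ¬∀⟶∃¬ m _ (λ w → (A c w ≟𝔹 true) →-dec (¬? (w ≟F v) →-dec colored? S w))
                    (λ others → ¬cv (force (decidable-stable (colored? S c) ¬¬cc) e others))
  ... | w , ¬forced with A c w ≟𝔹 true | w ≟F v
  ...   | no  ¬e  | _        = ⊥-elim (¬forced (λ e′ → ⊥-elim (¬e e′)))
  ...   | yes _   | yes w≡v  = ⊥-elim (¬forced (λ _ w≢v → ⊥-elim (w≢v w≡v)))
  ...   | yes e′  | no  w≢v  = w , (λ cw → ¬forced (λ _ _ → cw)) , w≢v , e′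

  -- A set coloring all but at most one vertex is at most one short of a
  -- forcing set, so any lower bound on forcing sets exceeds its size by ≤ 1.
  allButOne-bound : ∀ {a} S → (∀ T → IsForcingSet A T → a ≤ ∣ T ∣) →
                    AllButOne (Colored A S) → a ≤ suc ∣ S ∣
  allButOne-bound S lower one with allButOne-cover (colored? S) one
  ... | inj₁ all         = ≤-trans (lower S all) (n≤1+n ∣ S ∣)
  ... | inj₂ (v , cover) = ≤-trans (lower (S ∪ ⁅ v ⁆) (λ x → [ enlarge , at-v ]′ (cover x)))
                                   (∣p∪⁅x⁆∣≤1+∣p∣ S v)
    where
    enlarge : ∀ {x} → Colored A S x → Colored A (S ∪ ⁅ v ⁆) x
    enlarge = colored-mono (p⊆p∪q ⁅ v ⁆)
    at-v : ∀ {x} → x ≡ v → Colored A (S ∪ ⁅ v ⁆) x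
    at-v refl = initial (q⊆p∪q S ⁅ v ⁆ (x∈⁅x⁆ v))

  -- F(A) exists: the least size of a forcing set (⊤ is one).
  F-exists : ∃ (IsF A)
  F-exists with least (λ j → anySubset? (λ S → forcing? S ×-dec (∣ S ∣ ≟ℕ j)))
                      m (⊤ , (λ v → initial ∈⊤) , ∣⊤∣≡n m)
  ... | k , witness , minimal = k , witness , λ T forcing → minimal ∣ T ∣ (T , forcing , refl)

module Relabel {m : ℕ} {V : Set} (φ : Fin m ↔ V) (arc : V → V → Bool) where
  open Inverse φ using (to; from; strictlyInverseˡ; strictlyInverseʳ)

  D : Digraph m
  D i j = arc (to i) (to j)

  orientation : (∀ v → arc v v ≡ false) → (∀ v w → v ≢ w → arc w v ≡ not (arc v w)) →
                IsOrientationK m D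
  orientation irrefl flip =
    (λ i → irrefl (to i)) ,
    (λ i j i≢j → flip (to i) (to j) λ eq →
       i≢j (trans (sym (strictlyInverseʳ i)) (trans (cong from eq) (strictlyInverseʳ j))))

  fort : ∀ {U : V → Set} → IsFort arc U → IsFort D (U ∘ to)
  fort {U} fortU i j ¬Uc Uv e with fortU (to i) (to j) ¬Uc Uv e
  ... | w , Uw , w≢v , e′ =
    from w ,
    subst U (sym (strictlyInverseˡ w)) Uw ,
    (λ eq → w≢v (trans (sym (strictlyInverseˡ w)) (cong to eq))) ,
    trans (cong (arc (to i)) (strictlyInverseˡ w)) e′

  fort-empty : ∀ {S} → IsForcingSet D S → (U : V → Set) → IsFort arc U →
               (∀ v → from v ∈ S → ¬ U v) → ∀ v → ¬ U v
  fort-empty {S} forcing U fortU disjoint v Uv =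
    Forcing.fort-uncolored D (U ∘ to) (fort fortU)
      (λ i i∈S → disjoint (to i) (subst (_∈ S) (sym (strictlyInverseʳ i)) i∈S))
      (forcing (from v)) (subst U (sym (strictlyInverseˡ v)) Uv)

[]=-take : ∀ {X : Set} {m n} (xs : Vec X (m + n)) i {y} → xs [ i ↑ˡ n ]= y → take m xs [ i ]= y
[]=-take (x ∷ xs) zero    here      = here
[]=-take (x ∷ xs) (suc i) (there h) = there ([]=-take xs i h)

[]=-drop : ∀ {X : Set} m {n} (xs : Vec X (m + n)) i {y} → xs [ m ↑ʳ i ]= y → drop m xs [ i ]= y
[]=-drop zero    xs       i h         = h
[]=-drop (suc m) (x ∷ xs) i (there h) = []=-drop m xs i h

∣take∣+∣drop∣ : ∀ m {n} (xs : Subset (m + n)) → ∣ take m xs ∣ + ∣ drop m xs ∣ ≡ ∣ xs ∣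
∣take∣+∣drop∣ zero    xs             = refl
∣take∣+∣drop∣ (suc m) (inside  ∷ xs) = cong suc (∣take∣+∣drop∣ m xs)
∣take∣+∣drop∣ (suc m) (outside ∷ xs) = ∣take∣+∣drop∣ m xs

-- The Boolean strict order on ℕ is irreflexive and total on distinct numbers;
-- it orients the extra vertices transitively.
<ᵇ-irrefl : ∀ n → (n <ᵇ n) ≡ false
<ᵇ-irrefl zero    = refl
<ᵇ-irrefl (suc n) = <ᵇ-irrefl n

<ᵇ-flip : ∀ m n → m ≢ n → (n <ᵇ m) ≡ not (m <ᵇ n)
<ᵇ-flip zero    zero    m≢n = ⊥-elim (m≢n refl)
<ᵇ-flip zero    (suc n) _   = refl
<ᵇ-flip (suc m) zero    _   = refl
<ᵇ-flip (suc m) (suc n) m≢n = <ᵇ-flip m n (m≢n ∘ cong suc)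

data Block : Set where
  b₀ b₁ b₂ : Block

next : Block → Block
next b₀ = b₁
next b₁ = b₂
next b₂ = b₀

_≟ᵇ_ : (b b′ : Block) → Dec (b ≡ b′)
b₀ ≟ᵇ b₀ = yes refl
b₁ ≟ᵇ b₁ = yes refl
b₂ ≟ᵇ b₂ = yes refl
b₀ ≟ᵇ b₁ = no λ ()
b₀ ≟ᵇ b₂ = no λ ()
b₁ ≟ᵇ b₀ = no λ ()
b₁ ≟ᵇ b₂ = no λ ()
b₂ ≟ᵇ b₀ = no λ ()
b₂ ≟ᵇ b₁ = no λ ()

total : (Block → ℕ) → ℕ
total s = s b₀ + (s b₁ + s b₂)

total-rotate : ∀ s b → s b + (s (next b) + s (next (next b))) ≡ total s
total-rotate s b₀ = refl
total-rotate s b₁ = trans (sym (+-assoc (s b₁) (s b₂) (s b₀))) (+-comm (s b₁ + s b₂) (s b₀))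
total-rotate s b₂ = trans (+-comm (s b₂) (s b₀ + s b₁)) (+-assoc (s b₀) (s b₁) (s b₂))

sum-bound : ∀ {p a x y z} → p ≤ suc x → a ≤ suc y → a ≤ suc z → p + 2 * a ≤ x + (y + z) + 3
sum-bound {p} {a} {x} {y} {z} p≤ a≤y a≤z = begin
  p + 2 * a                         ≤⟨ +-mono-≤ p≤ (+-mono-≤ a≤y (+-mono-≤ a≤z (z≤n {0}))) ⟩
  suc x + (suc y + (suc z + 0))     ≡⟨ solve 3 (λ x y z → (con 1 :+ x) :+ ((con 1 :+ y) :+ ((con 1 :+ z) :+ con 0))
                                                     := x :+ (y :+ z) :+ con 3) refl x y z ⟩
  x + (y + z) + 3                   ∎
  where open ≤-Reasoning
        open +-*-Solver

module Blowup {p : ℕ} (r : ℕ) (A : Digraph p) (orientA : IsOrientationK p A) where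

  N : ℕ
  N = p + (p + (p + r))

  data Vertex : Set where
    copy  : Block → Fin p → Vertex
    extra : Fin r → Vertex

  copy-injective : ∀ {b b′ x y} → copy b x ≡ copy b′ y → x ≡ y
  copy-injective refl = refl

  vertices : Fin N ↔ Vertex
  vertices = ↔-trans +↔⊎ (↔-trans (↔-refl ⊎-↔ (↔-trans +↔⊎ (↔-refl ⊎-↔ +↔⊎))) layout)
    where
    Layout : Set
    Layout = Fin p ⊎ (Fin p ⊎ (Fin p ⊎ Fin r))

    toVertex : Layout → Vertex
    toVertex (inj₁ x)               = copy b₀ x
    toVertex (inj₂ (inj₁ x))        = copy b₁ x
    toVertex (inj₂ (inj₂ (inj₁ x))) = copy b₂ x
    toVertex (inj₂ (inj₂ (inj₂ w))) = extra w

    fromVertex : Vertex → Layout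
    fromVertex (copy b₀ x) = inj₁ x
    fromVertex (copy b₁ x) = inj₂ (inj₁ x)
    fromVertex (copy b₂ x) = inj₂ (inj₂ (inj₁ x))
    fromVertex (extra w)   = inj₂ (inj₂ (inj₂ w))

    toFrom : ∀ v → toVertex (fromVertex v) ≡ v
    toFrom (copy b₀ x) = refl
    toFrom (copy b₁ x) = refl
    toFrom (copy b₂ x) = refl
    toFrom (extra w)   = refl

    fromTo : ∀ l → fromVertex (toVertex l) ≡ l
    fromTo (inj₁ x)               = refl
    fromTo (inj₂ (inj₁ x))        = refl
    fromTo (inj₂ (inj₂ (inj₁ x))) = refl
    fromTo (inj₂ (inj₂ (inj₂ w))) = refl

    layout : Layout ↔ Vertex
    layout = mk↔ₛ′ toVertex fromVertex toFrom fromTo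

  open Inverse vertices using (from)

  copyArc : Block → Block → Fin p → Fin p → Bool
  copyArc b₀ b₀ x y = A x y
  copyArc b₁ b₁ x y = A x y
  copyArc b₂ b₂ x y = A x y
  copyArc b₀ b₁ _ _ = true
  copyArc b₁ b₂ _ _ = true
  copyArc b₂ b₀ _ _ = true
  copyArc b₁ b₀ _ _ = false
  copyArc b₂ b₁ _ _ = false
  copyArc b₀ b₂ _ _ = false

  copyArc-same : ∀ b x y → copyArc b b x y ≡ A x y
  copyArc-same b₀ x y = refl
  copyArc-same b₁ x y = refl
  copyArc-same b₂ x y = refl

  copyArc-next : ∀ b x y → copyArc b (next b) x y ≡ true
  copyArc-next b₀ x y = refl
  copyArc-next b₁ x y = refl
  copyArc-next b₂ x y = refl

  copyArc-uniform : ∀ {b b′} → b ≢ b′ → ∀ x y x′ y′ → copyArc b b′ x y ≡ copyArc b b′ x′ y′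
  copyArc-uniform {b₀} {b₀} b≢b′ = ⊥-elim (b≢b′ refl)
  copyArc-uniform {b₁} {b₁} b≢b′ = ⊥-elim (b≢b′ refl)
  copyArc-uniform {b₂} {b₂} b≢b′ = ⊥-elim (b≢b′ refl)
  copyArc-uniform {b₀} {b₁} _ _ _ _ _ = refl
  copyArc-uniform {b₁} {b₂} _ _ _ _ _ = refl
  copyArc-uniform {b₂} {b₀} _ _ _ _ _ = refl
  copyArc-uniform {b₁} {b₀} _ _ _ _ _ = refl
  copyArc-uniform {b₂} {b₁} _ _ _ _ _ = refl
  copyArc-uniform {b₀} {b₂} _ _ _ _ _ = refl

  arc : Vertex → Vertex → Bool
  arc (copy b x) (copy b′ y) = copyArc b b′ x y
  arc (copy _ _) (extra _)   = true
  arc (extra _)  (copy _ _)  = false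
  arc (extra w)  (extra w′)  = toℕ w <ᵇ toℕ w′

  arc-irrefl : ∀ v → arc v v ≡ false
  arc-irrefl (copy b x) = trans (copyArc-same b x x) (proj₁ orientA x)
  arc-irrefl (extra w)  = <ᵇ-irrefl (toℕ w)

  arc-flip : ∀ v w → v ≢ w → arc w v ≡ not (arc v w)
  arc-flip (copy b₀ x) (copy b₀ y) v≢w = proj₂ orientA x y (v≢w ∘ cong (copy b₀))
  arc-flip (copy b₁ x) (copy b₁ y) v≢w = proj₂ orientA x y (v≢w ∘ cong (copy b₁))
  arc-flip (copy b₂ x) (copy b₂ y) v≢w = proj₂ orientA x y (v≢w ∘ cong (copy b₂))
  arc-flip (copy b₀ x) (copy b₁ y) _   = refl
  arc-flip (copy b₀ x) (copy b₂ y) _   = refl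
  arc-flip (copy b₁ x) (copy b₀ y) _   = refl
  arc-flip (copy b₁ x) (copy b₂ y) _   = refl
  arc-flip (copy b₂ x) (copy b₀ y) _   = refl
  arc-flip (copy b₂ x) (copy b₁ y) _   = refl
  arc-flip (copy _ _)  (extra _)   _   = refl
  arc-flip (extra _)   (copy _ _)  _   = refl
  arc-flip (extra w)   (extra w′)  v≢w =
    <ᵇ-flip (toℕ w) (toℕ w′) (v≢w ∘ cong extra ∘ toℕ-injective)

  open Relabel vertices arc public using (D)
  open Relabel vertices arc using (orientation; fort-empty)

  D-orientation : IsOrientationK N D
  D-orientation = orientation arc-irrefl arc-flip

  InCopy : Block → (Fin p → Set) → Vertex → Set
  InCopy b X (copy b′ x) = b′ ≡ b × X x
  InCopy b X (extra _)   = ⊥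

  -- A fort of A with at least two elements, placed in one copy, is a fort of
  -- the blow-up: other copies see all of it or none of it.
  copy-fort : ∀ b {X} → IsFort A X → TwoOf X → IsFort arc (InCopy b X)
  copy-fort b fortX two c           (extra _)  _   ()
  copy-fort b fortX two (extra _)   (copy _ _) _   _         ()
  copy-fort b fortX two (copy b′ x) (copy _ y) ¬Uc (refl , Xy) e with b′ ≟ᵇ b
  ... | yes refl =
    let z , Xz , z≢y , e′ = fortX x y (λ Xx → ¬Uc (refl , Xx)) Xy (trans (sym (copyArc-same b x y)) e)
    in copy b z , (refl , Xz) , z≢y ∘ copy-injective , trans (copyArc-same b x z) e′
  ... | no b′≢b =
    let u , Xu , u≢y = avoid two y
    in copy b u , (refl , Xu) , u≢y ∘ copy-injective , trans (copyArc-uniform b′≢b x u x y) e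

  InCopies : (Block → Fin p → Set) → Vertex → Set
  InCopies X (copy b x) = X b x
  InCopies X (extra _)  = ⊥

  -- If every copy contains two elements of X, these form a fort: a vertex of
  -- copy b points to all of copy next b.
  cycle-fort : ∀ {X} → (∀ b → TwoOf (X b)) → IsFort arc (InCopies X)
  cycle-fort two c           (extra _)  _ ()
  cycle-fort two (extra _)   (copy _ _) _ _  ()
  cycle-fort two (copy b′ x) (copy b y) _ _  _ =
    let u , Xu , u≢y = avoid (two (next b′)) y
    in copy (next b′) u , Xu , u≢y ∘ copy-injective , copyArc-next b′ x u

  part : Subset N → Block → Subset p
  part S b₀ = take p S
  part S b₁ = take p (drop p S)
  part S b₂ = take p (drop p (drop p S))

  ∈-part : ∀ S b x → from (copy b x) ∈ S → x ∈ part S b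
  ∈-part S b₀ x h = []=-take S x h
  ∈-part S b₁ x h = []=-take (drop p S) x ([]=-drop p S _ h)
  ∈-part S b₂ x h = []=-take (drop p (drop p S)) x ([]=-drop p (drop p S) _ ([]=-drop p S _ h))

  parts-size : ∀ S → total (∣_∣ ∘ part S) ≤ ∣ S ∣
  parts-size S = begin
    ∣ t₀ ∣ + (∣ t₁ ∣ + ∣ t₂ ∣)                 ≤⟨ +-monoʳ-≤ ∣ t₀ ∣ (+-monoʳ-≤ ∣ t₁ ∣ (m≤m+n ∣ t₂ ∣ _)) ⟩
    ∣ t₀ ∣ + (∣ t₁ ∣ + (∣ t₂ ∣ + ∣ d₂ ∣))      ≡⟨ cong (λ k → ∣ t₀ ∣ + (∣ t₁ ∣ + k)) (∣take∣+∣drop∣ p d₁) ⟩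
    ∣ t₀ ∣ + (∣ t₁ ∣ + ∣ d₁ ∣)                 ≡⟨ cong (∣ t₀ ∣ +_) (∣take∣+∣drop∣ p d₀) ⟩
    ∣ t₀ ∣ + ∣ d₀ ∣                            ≡⟨ ∣take∣+∣drop∣ p S ⟩
    ∣ S ∣                                      ∎
    where
    open ≤-Reasoning
    d₀ : Subset (p + (p + r))
    d₀ = drop p S
    d₁ : Subset (p + r)
    d₁ = drop p d₀
    d₂ : Subset r
    d₂ = drop p d₁
    t₀ t₁ t₂ : Subset p
    t₀ = take p S
    t₁ = take p d₀
    t₂ = take p d₁

  module LowerBound {a : ℕ} (lower : ∀ T → IsForcingSet A T → a ≤ ∣ T ∣)
                    (S : Subset N) (forcing : IsForcingSet D S) where

    -- (1) The trace on copy b colors all but at most one vertex of A;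
    -- otherwise the uncolored vertices of copy b would form a fort of D.
    part-colors : ∀ b → AllButOne (Colored A (part S b))
    part-colors b with two-or-allButOne (Forcing.colored? A (part S b))
    ... | inj₂ one = one
    ... | inj₁ two@(u , _ , _ , ¬cu , _) =
      ⊥-elim (fort-empty forcing (InCopy b Uncolored)
                         (copy-fort b (Forcing.uncolored-fort A (part S b)) two)
                         disjoint (copy b u) (refl , ¬cu))
      where
      Uncolored : Fin p → Set
      Uncolored x = ¬ Colored A (part S b) x

      disjoint : ∀ v → from v ∈ S → ¬ InCopy b Uncolored v
      disjoint (copy _ x) x∈S (refl , ¬cx) = ¬cx (initial (∈-part S b x x∈S))

    part-bound : ∀ b → a ≤ suc ∣ part S b ∣
    part-bound b = Forcing.allButOne-bound A (part S b) lower (part-colors b)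

    -- (2) Not every trace misses two vertices of its copy; otherwise the
    -- missed vertices would form a fort of D.
    not-all-sparse : ¬ (∀ b → TwoOf (_∉ part S b))
    not-all-sparse two with two b₀
    ... | u , _ , _ , u∉ , _ =
      fort-empty forcing (InCopies Missed) (cycle-fort two) disjoint (copy b₀ u) u∉
      where
      Missed : Block → Fin p → Set
      Missed b x = x ∉ part S b

      disjoint : ∀ v → from v ∈ S → ¬ InCopies Missed v
      disjoint (copy b x) x∈S x∉ = x∉ (∈-part S b x x∈S)

    some-part-dense : ∃ λ b → AllButOne (_∈ part S b)
    some-part-dense with two-or-allButOne (_∈? part S b₀) | two-or-allButOne (_∈? part S b₁)
                       | two-or-allButOne (_∈? part S b₂)
    ... | inj₂ one | _        | _        = b₀ , one
    ... | inj₁ _   | inj₂ one | _        = b₁ , one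
    ... | inj₁ _   | inj₁ _   | inj₂ one = b₂ , one
    ... | inj₁ t₀  | inj₁ t₁  | inj₁ t₂  =
      ⊥-elim (not-all-sparse λ { b₀ → t₀ ; b₁ → t₁ ; b₂ → t₂ })

    lower-bound : p + 2 * a ≤ ∣ S ∣ + 3
    lower-bound with some-part-dense
    ... | b , dense =
      ≤-trans (sum-bound (allButOne-size (part S b) dense) (part-bound (next b))
                         (part-bound (next (next b))))
              (+-monoˡ-≤ 3 (≤-trans (≤-reflexive (total-rotate (∣_∣ ∘ part S) b)) (parts-size S)))

3p+r≡N : ∀ p r → 3 * p + r ≡ p + (p + (p + r))
3p+r≡N = solve 2 (λ p r → con 3 :* p :+ r := p :+ (p :+ (p :+ r))) refl
  where open +-*-Solver

lemma7 : ∀ (n p r : ℕ) → 1 ≤ p → r ≤ 2 → n ≡ 3 * p + r → 9 ≤ n →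
         ∀ (a b : ℕ) → IsMOFK p a → IsMOFK n b →
         p + 2 * a ≤ b + 3
lemma7 n p r _ _ refl _ a b ((A , orientA , _ , lower) , _) (_ , maximal)
  with Forcing.F-exists (Blowup.D r A orientA)
... | k , F-D@((S , forcing , ∣S∣≡k) , _) = begin
  p + 2 * a   ≤⟨ LowerBound.lower-bound lower S forcing ⟩
  ∣ S ∣ + 3   ≡⟨ cong (_+ 3) ∣S∣≡k ⟩
  k + 3       ≤⟨ +-monoˡ-≤ 3 (maximalN D D-orientation k F-D) ⟩
  b + 3       ∎
  where
  open Blowup r A orientA
  open ≤-Reasoning
  maximalN : ∀ (D′ : Digraph N) → IsOrientationK N D′ → ∀ k → IsF D′ k → k ≤ b
  maximalN = subst (λ m → ∀ (D′ : Digraph m) → IsOrientationK m D′ → ∀ k → IsF D′ k → k ≤ b)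
                   (3p+r≡N p r) maximal
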